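{- There is no $\mathcal{L}^1_\#$ sentence $\varphi$ in unary predicates $P,Q$ such that for every finite model $\mathcal{M}$, $\mathcal{M}\models\varphi$ iff $|P^\mathcal{M}|=2\,|Q^\mathcal{M}|$. That is, ``There are twice as many $P$s as $Q$s'' cannot be expressed in $\mathsf{MFO}^\phi(\#)$.
   Context: $\mathcal{L}^1_\#$ is monadic first-order logic with equality over finitely many unary predicates, extended with count comparisons $\#_x\varphi\succsim\#_y\psi$ (closed under Booleans, first-order quantifiers and nesting), where $\#_x\varphi\succsim\#_y\psi$ is true at an assignment iff $|\{d:\varphi\text{ holds with }x\mapsto d\}|\ge|\{d:\psi\text{ holds with }y\mapsto d\}|$. $\mathsf{MFO}^\phi(\#)$ is this logic over finite (nonempty) models. -}

module Defs where

open import Data.Nat using (ℕ; zero; suc; _+_; _*_; _≡ᵇ_; _≤ᵇ_)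
open import Data.Fin using (Fin)
import Data.Fin as F
open import Data.Bool using (Bool; true; false; not; _∧_; _∨_; if_then_else_)
open import Data.List using (List; []; _∷_; allFin; foldr; map)
open import Relation.Binary.PropositionalEquality using (_≡_)

Pred : Set
Pred = Fin 2

P Q : Pred
P = F.zero
Q = F.suc F.zero

Var : Set
Var = ℕ

data Form : Set where
  atom  : Pred → Var → Form
  equal : Var → Var → Form
  neg   : Form → Form
  conj  : Form → Form → Form
  ex    : Var → Form → Form
  cmp   : Var → Form → Var → Form → Form    -- #ₓ φ ≿ #ᵧ ψ  (binds x in φ, y in ψ)

free : Var → Form → Bool
free z (atom _ x)    = z ≡ᵇ x
free z (equal x y)   = (z ≡ᵇ x) ∨ (z ≡ᵇ y)
free z (neg φ)       = free z φ
free z (conj φ ψ)    = free z φ ∨ free z ψ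
free z (ex x φ)      = not (z ≡ᵇ x) ∧ free z φ
free z (cmp x φ y ψ) = (not (z ≡ᵇ x) ∧ free z φ) ∨ (not (z ≡ᵇ y) ∧ free z ψ)

Sentence : Form → Set
Sentence φ = ∀ z → free z φ ≡ false

Interp : ℕ → Set
Interp n = Pred → Fin n → Bool

Assign : ℕ → Set
Assign n = Var → Fin n

update : ∀ {n} → Assign n → Var → Fin n → Assign n
update ρ x d z = if′ (z ≡ᵇ x)
  where
    if′ : Bool → Fin _
    if′ true  = d
    if′ false = ρ z

countTrue : List Bool → ℕ
countTrue = foldr (λ b k → if b then suc k else k) 0

anyL : List Bool → Bool
anyL = foldr _∨_ false

_≥ᵇ_ : ℕ → ℕ → Bool
m ≥ᵇ n = n ≤ᵇ m

eval : ∀ {n} → Interp n → Assign n → Form → Bool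
eval I ρ (atom R x)    = I R (ρ x)
eval I ρ (equal x y)   = F.toℕ (ρ x) ≡ᵇ F.toℕ (ρ y)
eval I ρ (neg φ)       = not (eval I ρ φ)
eval I ρ (conj φ ψ)    = eval I ρ φ ∧ eval I ρ ψ
eval {n} I ρ (ex x φ)  = anyL (map (λ d → eval I (update ρ x d) φ) (allFin n))
eval {n} I ρ (cmp x φ y ψ) =
  countTrue (map (λ d → eval I (update ρ x d) φ) (allFin n))
    ≥ᵇ countTrue (map (λ d → eval I (update ρ y d) ψ) (allFin n))

-- M ⊨ φ for a sentence, on a nonempty finite model with domain Fin (suc m):
-- evaluated under the (arbitrary, irrelevant for sentences) constant assignment.
_⊨_ : ∀ {m} → Interp (suc m) → Form → Set
_⊨_ {m} I φ = eval I (λ _ → F.zero) φ ≡ true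

card : ∀ {n} → Interp n → Pred → ℕ
card {n} I R = countTrue (map (I R) (allFin n))

{-# OPTIONS --safe #-}
-- Let every variable of φ be below K, and consider a model with p elements in P and r further
-- elements in Q, where p > r + 2K.  Adding one more P element changes the truth value of no
-- formula with variables below K.  An assignment uses fewer than K elements, and any two unused
-- P elements are exchanged by an automorphism fixing the assignment; so a count #ₓψ grows by one
-- exactly when ψ holds of an unused P element, and then it is at least p − K, while otherwise it
-- is at most r + K.  As r + K < p − K, every comparison #ₓψ ≿ #ᵧχ keeps its truth value.  Taking
-- q > 2K, φ cannot separate 2q Ps and q Qs from 2q + 1 Ps and q Qs, although only the first
-- model has twice as many Ps as Qs.
module Submission where

open import Defs
open import Data.Bool using (Bool; true; false; not; _∧_; _∨_)
open import Data.Bool.Properties using (∨-zeroʳ)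
open import Data.Empty using (⊥-elim)
open import Data.Fin using (Fin; zero; suc; toℕ)
open import Data.Fin.Permutation as Perm using (Permutation; _⟨$⟩ʳ_; _⟨$⟩ˡ_)
import Data.Fin.Permutation.Components as PC
open import Data.Fin.Properties using (toℕ-injective) renaming (_≟_ to _≟ᶠ_; suc-injective to suc-injectiveᶠ)
open import Data.List using (List; []; _∷_; map; tabulate; allFin)
open import Data.List.Properties using (map-tabulate; map-cong)
open import Data.Nat using (ℕ; zero; suc; _+_; _*_; _∸_; _⊔_; _≤_; _<_; _≤ᵇ_; _<ᵇ_; _≡ᵇ_; z≤n; s≤s; s≤s⁻¹)
open import Data.Nat.Properties
open import Algebra.Properties.CommutativeMonoid.Sum +-0-commutativeMonoid using (sum; sum-cong-≗; sum-permute; sum-replicate-zero)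
open import Algebra.Properties.CommutativeSemigroup +-commutativeSemigroup using (interchange)
open import Data.Product using (Σ; ∃; _×_; _,_) renaming (map to map-Σ)
open import Data.Sum using (_⊎_; inj₁; inj₂)
open import Function using (_∘_; id; const)
open import Function.Bundles using (_⇔_; Equivalence; Injection; mk⇔)
open import Function.Definitions using (Injective)
open import Function.Properties.Inverse using (Inverse⇒Injection)
open import Relation.Binary.PropositionalEquality using (_≡_; _≢_; _≗_; refl; sym; trans; cong; cong₂; subst; module ≡-Reasoning)
open import Relation.Nullary using (¬_; yes; no; does)
open import Relation.Nullary.Decidable using (does-⇔; dec-true)

open Equivalence using (to; from)

private
  variable
    m n : ℕ

bit : Bool → ℕ
bit false = 0
bit true  = 1

count : (Fin n → Bool) → ℕ
count f = sum (bit ∘ f)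

count-cong : {f g : Fin n → Bool} → f ≗ g → count f ≡ count g
count-cong f≗g = sum-cong-≗ (cong bit ∘ f≗g)

count-permute : (π : Permutation n n) (f : Fin n → Bool) → count (f ∘ (π ⟨$⟩ʳ_)) ≡ count f
count-permute π f = sym (sum-permute (bit ∘ f) π)

count-false : count {n} (const false) ≡ 0
count-false {n} = sum-replicate-zero n

count-true : count {n} (const true) ≡ n
count-true {zero}  = refl
count-true {suc n} = cong suc count-true

countTrue-allFin : (f : Fin n → Bool) → countTrue (map f (allFin n)) ≡ count f
countTrue-allFin f = trans (cong countTrue (map-tabulate id f)) (countTrue-tabulate f)
  where
  countTrue-tabulate : (f : Fin n → Bool) → countTrue (tabulate f) ≡ count f
  countTrue-tabulate {zero}  f = refl
  countTrue-tabulate {suc n} f with f zero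
  ... | true  = cong suc (countTrue-tabulate (f ∘ suc))
  ... | false = countTrue-tabulate (f ∘ suc)

anyL≡1≤ᵇcountTrue : (bs : List Bool) → anyL bs ≡ (1 ≤ᵇ countTrue bs)
anyL≡1≤ᵇcountTrue []           = refl
anyL≡1≤ᵇcountTrue (true  ∷ bs) = refl
anyL≡1≤ᵇcountTrue (false ∷ bs) = anyL≡1≤ᵇcountTrue bs

bit-≤-union : ∀ {a b c} → (a ≡ true → b ≡ true ⊎ c ≡ true) → bit a ≤ bit b + bit c
bit-≤-union {false}               _ = z≤n
bit-≤-union {true} {true}         _ = s≤s z≤n
bit-≤-union {true} {false} {true} _ = s≤s z≤n
bit-≤-union {true} {false} {false} cover with cover refl
... | inj₁ ()
... | inj₂ ()

∨-≡true : ∀ a {b} → a ∨ b ≡ true → a ≡ true ⊎ b ≡ true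
∨-≡true true  _       = inj₁ refl
∨-≡true false b≡true = inj₂ b≡true

count-≤-union : {f g h : Fin n → Bool} → (∀ d → f d ≡ true → g d ≡ true ⊎ h d ≡ true) →
            count f ≤ count g + count h
count-≤-union {zero}  cover = z≤n
count-≤-union {suc n} {f} {g} {h} cover = begin
  bit (f zero) + count (f ∘ suc)
    ≤⟨ +-mono-≤ (bit-≤-union (cover zero)) (count-≤-union (cover ∘ suc)) ⟩
  (bit (g zero) + bit (h zero)) + (count (g ∘ suc) + count (h ∘ suc))
    ≡⟨ interchange (bit (g zero)) (bit (h zero)) (count (g ∘ suc)) (count (h ∘ suc)) ⟩
  count g + count h
    ∎
  where open ≤-Reasoning

count<⇒∃ : (f g : Fin n → Bool) → count g < count f → ∃ λ d → f d ≡ true × g d ≡ false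
count<⇒∃ {suc n} f g g<f with f zero in f0 | g zero in g0
... | true  | false = zero , f0 , g0
... | true  | true  = map-Σ suc id (count<⇒∃ (f ∘ suc) (g ∘ suc) (s≤s⁻¹ g<f))
... | false | false = map-Σ suc id (count<⇒∃ (f ∘ suc) (g ∘ suc) g<f)
... | false | true  = map-Σ suc id (count<⇒∃ (f ∘ suc) (g ∘ suc) (<⇒≤ g<f))

count-≟ : (a : Fin n) → count (λ d → does (a ≟ᶠ d)) ≡ 1
count-≟ {suc n} zero    = cong suc (count-false {n})
count-≟ {suc n} (suc a) = count-≟ a

used : ℕ → Assign n → Fin n → Bool
used zero    ρ d = false
used (suc K) ρ d = does (ρ K ≟ᶠ d) ∨ used K ρ d

count-used : ∀ K (ρ : Assign n) → count (used K ρ) ≤ K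
count-used {n} zero ρ = ≤-reflexive (count-false {n})
count-used (suc K) ρ = begin
  count (used (suc K) ρ)
    ≤⟨ count-≤-union (λ d → ∨-≡true (does (ρ K ≟ᶠ d))) ⟩
  count (λ d → does (ρ K ≟ᶠ d)) + count (used K ρ)
    ≤⟨ +-mono-≤ (≤-reflexive (count-≟ (ρ K))) (count-used K ρ) ⟩
  suc K
    ∎
  where open ≤-Reasoning

used-image : ∀ K (ρ : Assign n) z → z < K → used K ρ (ρ z) ≡ true
used-image (suc K) ρ z z<1+K with m<1+n⇒m<n∨m≡n z<1+K
... | inj₁ z<K  = trans (cong (does (ρ K ≟ᶠ ρ z) ∨_) (used-image K ρ z z<K)) (∨-zeroʳ _)
... | inj₂ refl = cong (_∨ used K ρ (ρ K)) (dec-true (ρ K ≟ᶠ ρ K) refl)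

Fresh : ℕ → Assign n → Fin n → Set
Fresh K ρ a = ∀ z → z < K → ρ z ≢ a

unused⇒fresh : ∀ {K ρ} {a : Fin n} → used K ρ a ≡ false → Fresh K ρ a
unused⇒fresh {K = K} {ρ} unused z z<K refl with trans (sym unused) (used-image K ρ z z<K)
... | ()

data Shift (U L : ℕ) : ℕ → ℕ → Set where
  stay : ∀ {c} → c ≤ U → Shift U L c c
  step : ∀ {c} → L ≤ c → Shift U L c (suc c)

shift : ∀ {U L c} (b : Bool) → (b ≡ true → L ≤ c) → (b ≡ false → c ≤ U) → Shift U L c (bit b + c)
shift true  lower _     = step (lower refl)
shift false _     upper = stay (upper refl)

Shift-pos : ∀ {U L a a′} → 0 < L → Shift U L a a′ → (0 < a ⇔ 0 < a′)
Shift-pos 0<L (stay _)   = mk⇔ id id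
Shift-pos 0<L (step L≤a) = mk⇔ (const (s≤s z≤n)) (const (<-≤-trans 0<L L≤a))

Shift-≤ : ∀ {U L a a′ b b′} → U < L → Shift U L a a′ → Shift U L b b′ → (b ≤ a ⇔ b′ ≤ a′)
Shift-≤ gap (stay _)   (stay _)   = mk⇔ id id
Shift-≤ gap (step _)   (step _)   = mk⇔ s≤s s≤s⁻¹
Shift-≤ gap (step L≤a) (stay b≤U) = mk⇔ m≤n⇒m≤1+n (const (<⇒≤ (≤-<-trans b≤U (<-≤-trans gap L≤a))))
Shift-≤ {a = a} {b = b} gap (stay a≤U) (step L≤b) =
  mk⇔ (⊥-elim ∘ <⇒≱ a<b) (⊥-elim ∘ <⇒≱ a<b ∘ ≤-trans (n≤1+n b))
  where
  a<b : a < b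
  a<b = ≤-<-trans a≤U (<-≤-trans gap L≤b)

sat : Interp n → Assign n → Var → Form → Fin n → Bool
sat I ρ x φ d = eval I (update ρ x d) φ

#sat : Interp n → Assign n → Var → Form → ℕ
#sat I ρ x φ = count (sat I ρ x φ)

eval-ex : ∀ (I : Interp n) ρ x φ → eval I ρ (ex x φ) ≡ (1 ≤ᵇ #sat I ρ x φ)
eval-ex {n} I ρ x φ =
  trans (anyL≡1≤ᵇcountTrue (map (sat I ρ x φ) (allFin n)))
        (cong (1 ≤ᵇ_) (countTrue-allFin (sat I ρ x φ)))

eval-cmp : ∀ (I : Interp n) ρ x φ y ψ → eval I ρ (cmp x φ y ψ) ≡ (#sat I ρ y ψ ≤ᵇ #sat I ρ x φ)
eval-cmp I ρ x φ y ψ = cong₂ _≥ᵇ_ (countTrue-allFin (sat I ρ x φ)) (countTrue-allFin (sat I ρ y ψ))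

-- does-⇔ applies since m ≤ᵇ n and m ≡ᵇ n are definitionally does (m ≤? n) and does (m ≟ n).
ex-cong : (I : Interp m) (ρ : Assign m) (J : Interp n) (σ : Assign n) (x : Var) (φ : Form) →
          (0 < #sat I ρ x φ ⇔ 0 < #sat J σ x φ) → eval I ρ (ex x φ) ≡ eval J σ (ex x φ)
ex-cong I ρ J σ x φ pos⇔pos =
  trans (eval-ex I ρ x φ) (trans (does-⇔ pos⇔pos (1 ≤? _) (1 ≤? _)) (sym (eval-ex J σ x φ)))

cmp-cong : (I : Interp m) (ρ : Assign m) (J : Interp n) (σ : Assign n)
           (x : Var) (φ : Form) (y : Var) (ψ : Form) →
           (#sat I ρ y ψ ≤ #sat I ρ x φ ⇔ #sat J σ y ψ ≤ #sat J σ x φ) →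
           eval I ρ (cmp x φ y ψ) ≡ eval J σ (cmp x φ y ψ)
cmp-cong I ρ J σ x φ y ψ ≤⇔≤ =
  trans (eval-cmp I ρ x φ y ψ) (trans (does-⇔ ≤⇔≤ (_ ≤? _) (_ ≤? _)) (sym (eval-cmp J σ x φ y ψ)))

varBound : Form → ℕ
varBound (atom _ x)    = x
varBound (equal x y)   = x ⊔ y
varBound (neg φ)       = varBound φ
varBound (conj φ ψ)    = varBound φ ⊔ varBound ψ
varBound (ex _ φ)      = varBound φ
varBound (cmp _ φ _ ψ) = varBound φ ⊔ varBound ψ

AgreeBelow : ℕ → Assign n → Assign n → Set
AgreeBelow K ρ σ = ∀ z → z < K → ρ z ≡ σ z

update-agree : ∀ {K} {ρ σ : Assign n} x d → AgreeBelow K ρ σ → AgreeBelow K (update ρ x d) (update σ x d)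
update-agree x d ρ≈σ z z<K with z ≡ᵇ x
... | true  = refl
... | false = ρ≈σ z z<K

update-∘ : (g : Fin m → Fin n) (ρ : Assign m) (x : Var) → ∀ {d e} → g e ≡ d →
           update (g ∘ ρ) x d ≗ g ∘ update ρ x e
update-∘ g ρ x ge≡d z with z ≡ᵇ x
... | true  = sym ge≡d
... | false = refl

eval-agree : ∀ {K} (I : Interp n) φ → varBound φ < K →
             ∀ {ρ σ} → AgreeBelow K ρ σ → eval I ρ φ ≡ eval I σ φ
eval-agree I (atom R x)    x<K ρ≈σ = cong (I R) (ρ≈σ x x<K)
eval-agree I (equal x y)   b   ρ≈σ =
  cong₂ (λ a c → toℕ a ≡ᵇ toℕ c) (ρ≈σ x (m⊔n<o⇒m<o x y b)) (ρ≈σ y (m⊔n<o⇒n<o x y b))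
eval-agree I (neg φ)       b   ρ≈σ = cong not (eval-agree I φ b ρ≈σ)
eval-agree I (conj φ ψ)    b   ρ≈σ =
  cong₂ _∧_ (eval-agree I φ (m⊔n<o⇒m<o _ _ b) ρ≈σ) (eval-agree I ψ (m⊔n<o⇒n<o _ _ b) ρ≈σ)
eval-agree {n} I (ex x φ)  b   ρ≈σ =
  cong anyL (map-cong (λ d → eval-agree I φ b (update-agree x d ρ≈σ)) (allFin n))
eval-agree {n} I (cmp x φ y ψ) b ρ≈σ = cong₂ _≥ᵇ_
  (cong countTrue (map-cong (λ d → eval-agree I φ (m⊔n<o⇒m<o _ _ b) (update-agree x d ρ≈σ)) (allFin n)))
  (cong countTrue (map-cong (λ d → eval-agree I ψ (m⊔n<o⇒n<o _ _ b) (update-agree y d ρ≈σ)) (allFin n)))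

eval-cong : (I : Interp n) (φ : Form) {ρ σ : Assign n} → ρ ≗ σ → eval I ρ φ ≡ eval I σ φ
eval-cong I φ ρ≗σ = eval-agree I φ (n<1+n (varBound φ)) (λ z _ → ρ≗σ z)

toℕ-≡ᵇ-injective : {g : Fin m → Fin n} → Injective _≡_ _≡_ g →
                   ∀ a b → (toℕ (g a) ≡ᵇ toℕ (g b)) ≡ (toℕ a ≡ᵇ toℕ b)
toℕ-≡ᵇ-injective {g = g} g-injective a b = does-⇔
  (mk⇔ (cong toℕ ∘ g-injective ∘ toℕ-injective) (cong (toℕ ∘ g) ∘ toℕ-injective))
  (toℕ (g a) ≟ toℕ (g b)) (toℕ a ≟ toℕ b)

≡⇒⇔ : ∀ {A B : Set} → A ≡ B → A ⇔ B
≡⇒⇔ refl = mk⇔ id id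

module _ (I : Interp n) (π : Permutation n n) (π-preserves : ∀ R d → I R (π ⟨$⟩ʳ d) ≡ I R d) where

  eval-automorphism : ∀ φ ρ → eval I ((π ⟨$⟩ʳ_) ∘ ρ) φ ≡ eval I ρ φ
  #sat-automorphism : ∀ x φ ρ → #sat I ((π ⟨$⟩ʳ_) ∘ ρ) x φ ≡ #sat I ρ x φ

  eval-automorphism (atom R x)    ρ = π-preserves R (ρ x)
  eval-automorphism (equal x y)   ρ =
    toℕ-≡ᵇ-injective (Injection.injective (Inverse⇒Injection π)) (ρ x) (ρ y)
  eval-automorphism (neg φ)       ρ = cong not (eval-automorphism φ ρ)
  eval-automorphism (conj φ ψ)    ρ = cong₂ _∧_ (eval-automorphism φ ρ) (eval-automorphism ψ ρ)
  eval-automorphism (ex x φ)      ρ =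
    ex-cong I ((π ⟨$⟩ʳ_) ∘ ρ) I ρ x φ (≡⇒⇔ (cong (0 <_) (#sat-automorphism x φ ρ)))
  eval-automorphism (cmp x φ y ψ) ρ =
    cmp-cong I ((π ⟨$⟩ʳ_) ∘ ρ) I ρ x φ y ψ
      (≡⇒⇔ (cong₂ _≤_ (#sat-automorphism y ψ ρ) (#sat-automorphism x φ ρ)))

  #sat-automorphism x φ ρ = begin
    count (sat I ((π ⟨$⟩ʳ_) ∘ ρ) x φ)
      ≡⟨ count-cong (λ d → eval-cong I φ (update-∘ (π ⟨$⟩ʳ_) ρ x (Perm.inverseʳ π {d}))) ⟩
    count (λ d → eval I ((π ⟨$⟩ʳ_) ∘ update ρ x (π ⟨$⟩ˡ d)) φ)
      ≡⟨ count-cong (λ d → eval-automorphism φ (update ρ x (π ⟨$⟩ˡ d))) ⟩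
    count (sat I ρ x φ ∘ (π ⟨$⟩ˡ_))
      ≡⟨ count-permute (Perm.flip π) (sat I ρ x φ) ⟩
    count (sat I ρ x φ) ∎
    where open ≡-Reasoning

transpose-source : (a b : Fin n) → PC.transpose a b a ≡ b
transpose-source a b with a ≟ᶠ a
... | yes _   = refl
... | no a≢a = ⊥-elim (a≢a refl)

transpose-fixes : ∀ {a b d : Fin n} → d ≢ a → d ≢ b → PC.transpose a b d ≡ d
transpose-fixes {a = a} {b} {d} d≢a d≢b with d ≟ᶠ a
... | yes d≡a = ⊥-elim (d≢a d≡a)
... | no _ with d ≟ᶠ b
...   | yes d≡b = ⊥-elim (d≢b d≡b)
...   | no _    = refl

transpose-preserves : ∀ {A : Set} (g : Fin n → A) {a b} → g a ≡ g b →
                      ∀ d → g (PC.transpose a b d) ≡ g d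
transpose-preserves g {a} {b} ga≡gb d with d ≟ᶠ a
... | yes refl = sym ga≡gb
... | no _ with d ≟ᶠ b
...   | yes refl = ga≡gb
...   | no _     = refl

sat-fresh-≡ : ∀ {K} (I : Interp n) {a b} → (∀ R → I R a ≡ I R b) →
              ∀ {ρ} → Fresh K ρ a → Fresh K ρ b →
              ∀ x φ → varBound φ < K → sat I ρ x φ a ≡ sat I ρ x φ b
sat-fresh-≡ {n} {K} I {a} {b} same-type {ρ} a-fresh b-fresh x φ φ<K = begin
  eval I (update ρ x a) φ
    ≡⟨ eval-automorphism I τ (λ R → transpose-preserves (I R) (same-type R)) φ _ ⟨
  eval I ((τ ⟨$⟩ʳ_) ∘ update ρ x a) φ
    ≡⟨ eval-agree I φ φ<K τ∘ρ[x↦a]≈ρ[x↦b] ⟩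
  eval I (update ρ x b) φ
    ∎
  where
  open ≡-Reasoning
  τ : Permutation n n
  τ = Perm.transpose a b
  τ∘ρ[x↦a]≈ρ[x↦b] : AgreeBelow K ((τ ⟨$⟩ʳ_) ∘ update ρ x a) (update ρ x b)
  τ∘ρ[x↦a]≈ρ[x↦b] z z<K with z ≡ᵇ x
  ... | true  = transpose-source a b
  ... | false = transpose-fixes (a-fresh z z<K) (b-fresh z z<K)

below : ℕ → Fin n → Bool
below p d = toℕ d <ᵇ p

prefixModel : ℕ → ∀ {n} → Interp n
prefixModel p zero       = below p
prefixModel p (suc zero) = not ∘ below p

prefixModel-type : ∀ p {a b : Fin n} → below p a ≡ below p b →
                   ∀ R → prefixModel p R a ≡ prefixModel p R b
prefixModel-type p same zero       = same
prefixModel-type p same (suc zero) = cong not same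

prefixModel-suc : ∀ p R (d : Fin n) → prefixModel (suc p) R (suc d) ≡ prefixModel p R d
prefixModel-suc p zero       d = refl
prefixModel-suc p (suc zero) d = refl

count-below : ∀ p r → count {p + r} (below p) ≡ p
count-below zero    r = count-false {r}
count-below (suc p) r = cong suc (count-below p r)

count-not-below : ∀ p r → count {p + r} (not ∘ below p) ≡ r
count-not-below zero    r = count-true
count-not-below (suc p) r = count-not-below p r

card-prefixModel-P : ∀ p r → card (prefixModel p {p + r}) P ≡ p
card-prefixModel-P p r = trans (countTrue-allFin {p + r} (below p)) (count-below p r)

card-prefixModel-Q : ∀ p r → card (prefixModel p {p + r}) Q ≡ r
card-prefixModel-Q p r = trans (countTrue-allFin {p + r} (not ∘ below p)) (count-not-below p r)

module PrefixExtension (p r K : ℕ) (margin : K + K + r < p) where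

  private
    M : Interp (p + r)
    M = prefixModel p

    M⁺ : Interp (suc p + r)
    M⁺ = prefixModel (suc p)

    inP : Fin (p + r) → Bool
    inP = below p

  gap : K + r < p ∸ K
  gap = m+n≤o⇒m≤o∸n (suc (K + r)) (subst (_≤ p) (cong suc K+K+r≡K+r+K) margin)
    where
    K+K+r≡K+r+K : K + K + r ≡ K + r + K
    K+K+r≡K+r+K = trans (+-assoc K K r) (+-comm K (K + r))

  unused-P-element : (ρ : Assign (p + r)) → ∃ λ a → inP a ≡ true × used K ρ a ≡ false
  unused-P-element ρ = count<⇒∃ inP (used K ρ) (begin-strict
    count (used K ρ) ≤⟨ count-used K ρ ⟩
    K                <⟨ ≤-<-trans (≤-trans (m≤m+n K K) (m≤m+n (K + K) r)) margin ⟩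
    p                ≡⟨ count-below p r ⟨
    count inP        ∎)
    where open ≤-Reasoning

  module _ {ρ : Assign (p + r)} {a} (a-P : inP a ≡ true) (a-unused : used K ρ a ≡ false)
           (x : Var) (φ : Form) (φ<K : varBound φ < K) where

    sat-like-a : ∀ {d} → inP d ≡ true → used K ρ d ≡ false → sat M ρ x φ d ≡ sat M ρ x φ a
    sat-like-a d-P d-unused = sat-fresh-≡ M (prefixModel-type p (trans d-P (sym a-P)))
      (unused⇒fresh d-unused) (unused⇒fresh a-unused) x φ φ<K

    #sat-lower : sat M ρ x φ a ≡ true → p ∸ K ≤ #sat M ρ x φ
    #sat-lower a-sat = m≤n+o⇒m∸n≤o p K (begin
      p                               ≡⟨ count-below p r ⟨
      count inP                       ≤⟨ count-≤-union cover ⟩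
      count (used K ρ) + #sat M ρ x φ ≤⟨ +-monoˡ-≤ (#sat M ρ x φ) (count-used K ρ) ⟩
      K + #sat M ρ x φ                ∎)
      where
      open ≤-Reasoning
      cover : ∀ d → inP d ≡ true → used K ρ d ≡ true ⊎ sat M ρ x φ d ≡ true
      cover d d-P with used K ρ d in d-used
      ... | true  = inj₁ refl
      ... | false = inj₂ (trans (sat-like-a d-P d-used) a-sat)

    #sat-upper : sat M ρ x φ a ≡ false → #sat M ρ x φ ≤ K + r
    #sat-upper a-unsat = begin
      #sat M ρ x φ
        ≤⟨ count-≤-union cover ⟩
      count (used K ρ) + count (not ∘ inP)
        ≤⟨ +-mono-≤ (count-used K ρ) (≤-reflexive (count-not-below p r)) ⟩
      K + r
        ∎
      where
      open ≤-Reasoning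
      cover : ∀ d → sat M ρ x φ d ≡ true → used K ρ d ≡ true ⊎ not (inP d) ≡ true
      cover d d-sat with used K ρ d in d-used | inP d in d-P
      ... | true  | _     = inj₁ refl
      ... | false | false = inj₂ refl
      ... | false | true  with trans (sym d-sat) (trans (sat-like-a d-P d-used) a-unsat)
      ...   | ()

  eval-extend : ∀ φ → varBound φ < K → ∀ ρ → eval M⁺ (suc ∘ ρ) φ ≡ eval M ρ φ
  #sat-extend : ∀ x φ → varBound φ < K → ∀ ρ →
                Shift (K + r) (p ∸ K) (#sat M ρ x φ) (#sat M⁺ (suc ∘ ρ) x φ)
  sat-extend-suc : ∀ x φ → varBound φ < K → ∀ ρ d → sat M⁺ (suc ∘ ρ) x φ (suc d) ≡ sat M ρ x φ d

  eval-extend (atom R x)    _   ρ = prefixModel-suc p R (ρ x)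
  eval-extend (equal x y)   _   ρ = refl
  eval-extend (neg φ)       φ<K ρ = cong not (eval-extend φ φ<K ρ)
  eval-extend (conj φ ψ)    b   ρ =
    cong₂ _∧_ (eval-extend φ (m⊔n<o⇒m<o _ _ b) ρ) (eval-extend ψ (m⊔n<o⇒n<o _ _ b) ρ)
  eval-extend (ex x φ)      φ<K ρ =
    sym (ex-cong M ρ M⁺ (suc ∘ ρ) x φ (Shift-pos (≤-trans (s≤s z≤n) gap) (#sat-extend x φ φ<K ρ)))
  eval-extend (cmp x φ y ψ) b   ρ = sym (cmp-cong M ρ M⁺ (suc ∘ ρ) x φ y ψ
    (Shift-≤ gap (#sat-extend x φ (m⊔n<o⇒m<o _ _ b) ρ) (#sat-extend y ψ (m⊔n<o⇒n<o _ _ b) ρ)))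

  sat-extend-suc x φ φ<K ρ d =
    trans (eval-cong M⁺ φ (update-∘ suc ρ x refl)) (eval-extend φ φ<K (update ρ x d))

  #sat-extend x φ φ<K ρ with unused-P-element ρ
  ... | a , a-P , a-unused = subst (Shift (K + r) (p ∸ K) (#sat M ρ x φ)) (sym #sat⁺≡)
    (shift (sat M ρ x φ a) (#sat-lower a-P a-unused x φ φ<K) (#sat-upper a-P a-unused x φ φ<K))
    where
    new≡a : sat M⁺ (suc ∘ ρ) x φ zero ≡ sat M ρ x φ a
    new≡a = trans
      (sat-fresh-≡ M⁺ (prefixModel-type (suc p) (sym a-P)) (λ _ _ ())
                   (λ z z<K → unused⇒fresh a-unused z z<K ∘ suc-injectiveᶠ) x φ φ<K)
      (sat-extend-suc x φ φ<K ρ a)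
    #sat⁺≡ : #sat M⁺ (suc ∘ ρ) x φ ≡ bit (sat M ρ x φ a) + #sat M ρ x φ
    #sat⁺≡ = cong₂ _+_ (cong bit new≡a) (count-cong (sat-extend-suc x φ φ<K ρ))

-- ⊨ evaluates under const zero, which lies outside the image of the embedding suc used by
-- eval-extend; swapping the P elements zero and suc zero of the larger model fixes this.
-- So φ need not be a sentence.
prefixModel-⊨-suc : ∀ {p r K} φ → varBound φ < K → K + K + r < suc p →
                    prefixModel (suc p) {suc p + r} ⊨ φ →
                    prefixModel (suc (suc p)) {suc (suc p) + r} ⊨ φ
prefixModel-⊨-suc {p} {r} {K} φ φ<K margin M⊨φ = begin
  eval M⁺ (const zero) φ        ≡⟨ eval-automorphism M⁺ swap swap-preserves φ (const zero) ⟨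
  eval M⁺ (const (suc zero)) φ  ≡⟨ eval-extend φ φ<K (const zero) ⟩
  eval M (const zero) φ         ≡⟨ M⊨φ ⟩
  true                          ∎
  where
  open ≡-Reasoning
  open PrefixExtension (suc p) r K margin using (eval-extend)
  M : Interp (suc p + r)
  M = prefixModel (suc p)
  M⁺ : Interp (suc (suc p) + r)
  M⁺ = prefixModel (suc (suc p))
  swap : Permutation (suc (suc p) + r) (suc (suc p) + r)
  swap = Perm.transpose zero (suc zero)
  swap-preserves : ∀ R d → M⁺ R (swap ⟨$⟩ʳ d) ≡ M⁺ R d
  swap-preserves R = transpose-preserves (M⁺ R) (prefixModel-type (suc (suc p)) refl R)

fact3p6 : ¬ (Σ Form λ φ → Sentence φ ×
            ((m : ℕ) (I : Interp (suc m)) → (I ⊨ φ) ⇔ (card I P ≡ 2 * card I Q)))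
fact3p6 (φ , _ , φ-defines) = 1+n≢n (begin
  suc (q + q)    ≡⟨ card-prefixModel-P (suc (q + q)) q ⟨
  card M⁺ P      ≡⟨ to (φ-defines _ M⁺) (prefixModel-⊨-suc φ ≤-refl ≤-refl M⊨φ) ⟩
  2 * card M⁺ Q  ≡⟨ cong (2 *_) (card-prefixModel-Q (suc (q + q)) q) ⟩
  2 * q          ≡⟨ 2q≡q+q ⟩
  q + q          ∎)
  where
  open ≡-Reasoning
  K q : ℕ
  K = suc (varBound φ)
  q = suc (K + K)
  M : Interp (q + q + q)
  M = prefixModel (q + q)
  M⁺ : Interp (suc (q + q) + q)
  M⁺ = prefixModel (suc (q + q))
  2q≡q+q : 2 * q ≡ q + q
  2q≡q+q = cong (q +_) (+-identityʳ q)
  M⊨φ : M ⊨ φ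
  M⊨φ = from (φ-defines _ M)
    (trans (card-prefixModel-P (q + q) q) (sym (trans (cong (2 *_) (card-prefixModel-Q (q + q) q)) 2q≡q+q)))
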